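{- Let $G$ be a unicyclic graph of order $n$ such that $G\not\cong U_n$ and $G\not\cong C_n$, and let $v\in V(G)$ be a leaf. Then $G-N[v]$ has at least two edges.
   Context: All graphs are finite, simple and undirected. A unicyclic graph is a connected graph with as many edges as vertices. $C_n$ is the cycle of order $n$; $U_n=(K_2\cup\overline{K_{n-3}})\vee K_1$. A leaf is a vertex of degree $1$. $N[v]$ is the closed neighbourhood of $v$ and $G-N[v]$ is obtained from $G$ by deleting all vertices of $N[v]$. -}

module Defs where

open import Data.Nat using (ℕ; zero; suc; _≡ᵇ_)
open import Data.Bool using (Bool; true; false; _∧_; _∨_; not; if_then_else_)
open import Data.Fin using (Fin; toℕ; _<?_; _≟_)
open import Data.List using (List; allFin; map)
open import Data.Nat.ListAction using (sum)
open import Data.Product using (Σ; _×_)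
open import Relation.Nullary.Decidable using (⌊_⌋)
open import Relation.Binary.PropositionalEquality using (_≡_)
open import Function.Bundles using (_↔_; Inverse)

record Graph (n : ℕ) : Set where
  field
    Adj    : Fin n → Fin n → Bool
    sym    : ∀ i j → Adj i j ≡ Adj j i
    irrefl : ∀ i → Adj i i ≡ false
open Graph public

count : Bool → ℕ
count true  = 1
count false = 0

degree : ∀ {n} → Graph n → Fin n → ℕ
degree {n} G v = sum (map (λ j → count (Adj G v j)) (allFin n))

isLeaf : ∀ {n} → Graph n → Fin n → Set
isLeaf G v = degree G v ≡ 1

inducedEdges : ∀ {n} → Graph n → (Fin n → Bool) → ℕ
inducedEdges {n} G S =
  sum (map (λ i → sum (map (λ j → count (⌊ i <? j ⌋ ∧ S i ∧ S j ∧ Adj G i j))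
                           (allFin n)))
           (allFin n))

edges : ∀ {n} → Graph n → ℕ
edges G = inducedEdges G (λ _ → true)

closedNbhd : ∀ {n} → Graph n → Fin n → Fin n → Bool
closedNbhd G v w = ⌊ v ≟ w ⌋ ∨ Adj G v w

edgesMinusClosedNbhd : ∀ {n} → Graph n → Fin n → ℕ
edgesMinusClosedNbhd G v = inducedEdges G (λ w → not (closedNbhd G v w))

data Walk {n} (G : Graph n) : Fin n → Fin n → Set where
  here : ∀ {u} → Walk G u u
  step : ∀ {u w v} → Adj G u w ≡ true → Walk G w v → Walk G u v

Connected : ∀ {n} → Graph n → Set
Connected {n} G = ∀ (u v : Fin n) → Walk G u v

Unicyclic : ∀ {n} → Graph n → Set
Unicyclic {n} G = Connected G × edges G ≡ n

-- adjacency of the cycle C_n on vertices 0,…,n-1 (i ~ i+1, and 0 ~ n-1);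
-- only meaningful (simple) for n ≥ 3
cycleAdj : (n : ℕ) → Fin n → Fin n → Bool
cycleAdj zero     () _
cycleAdj (suc m) i j =
  (suc a ≡ᵇ b) ∨ (suc b ≡ᵇ a) ∨ ((a ≡ᵇ 0) ∧ (b ≡ᵇ m)) ∨ ((b ≡ᵇ 0) ∧ (a ≡ᵇ m))
  where a = toℕ i
        b = toℕ j

-- adjacency of U_n = (K_2 ∪ complement K_{n-3}) ∨ K_1:
-- vertex 0 is the K_1 (adjacent to all others), vertices 1,2 form the K_2,
-- vertices 3,…,n-1 are otherwise isolated; meaningful for n ≥ 3
UAdj : (n : ℕ) → Fin n → Fin n → Bool
UAdj n i j =
  ((a ≡ᵇ 0) ∧ not (b ≡ᵇ 0)) ∨ ((b ≡ᵇ 0) ∧ not (a ≡ᵇ 0))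
  ∨ ((a ≡ᵇ 1) ∧ (b ≡ᵇ 2)) ∨ ((a ≡ᵇ 2) ∧ (b ≡ᵇ 1))
  where a = toℕ i
        b = toℕ j

IsoTo : ∀ {n} → Graph n → (Fin n → Fin n → Bool) → Set
IsoTo {n} G H =
  Σ (Fin n ↔ Fin n) λ σ →
    ∀ i j → Adj G i j ≡ H (Inverse.to σ i) (Inverse.to σ j)

module Submission where

-- Let u be the unique neighbour of the leaf v, so N[v] = {v, u}. Every edge of G outside G − N[v]
-- therefore contains u, whence n = |E(G)| ≤ |E(G − N[v])| + deg u ≤ |E(G − N[v])| + (n − 1).
-- If G − N[v] had only one edge ab, equality would force deg u = n − 1, and G would consist of the
-- star at u together with the chord ab, i.e. G ≅ U_n.

open import Defs hiding (sym)
open Graph using () renaming (sym to adj-sym)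
open import Data.Nat using (ℕ; zero; suc; _+_; _≤_; _<_; _≥_; z≤n; s≤s)
open import Data.Nat.Properties
  using (≤-refl; ≤-trans; ≤-reflexive; +-mono-≤; +-monoʳ-≤; +-comm; +-identityʳ;
         m≤m+n; m≤n+m; ≮⇒≥; <⇒≱; <-irrefl; +-0-commutativeMonoid;
         module ≤-Reasoning)
open import Data.Bool using (Bool; true; false; _∧_; _∨_; not)
open import Data.Bool.Properties using (∧-conicalˡ; ∧-conicalʳ; ∨-zeroʳ)
open import Data.Fin using (Fin; zero; suc; _<?_; _≟_; punchIn) renaming (_<_ to _<ᶠ_)
open import Data.Fin.Patterns using (0F; 1F; 2F)
open import Data.Fin.Properties using (punchInᵢ≢i; <-cmp; <-asym)
open import Data.Fin.Permutation using (Permutation′; id; _⟨$⟩ʳ_; _⟨$⟩ˡ_; _∘ₚ_; transpose; flip; inverseˡ; inverseʳ)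
import Data.Fin.Permutation.Components as Components
open import Data.List using (tabulate; map; allFin)
import Data.Nat.ListAction as ListAction
open import Data.Product using (Σ; ∃; ∃₂; _×_; _,_; proj₁; proj₂)
open import Data.Sum using (_⊎_; inj₁; inj₂)
open import Data.Empty using (⊥; ⊥-elim)
open import Function using (_∘_)
open import Relation.Binary using (tri<; tri≈; tri>)
open import Relation.Binary.PropositionalEquality
open import Relation.Nullary using (¬_; Dec; yes; no; contradiction)
open import Relation.Nullary.Decidable using (⌊_⌋; dec-true; dec-false)
open import Algebra.Properties.CommutativeMonoid.Sum +-0-commutativeMonoid
  using (sum; ∑-distrib-+; ∑-comm; sum-cong-≗; sum-remove; sum-replicate-zero)

⌊⌋-yes : ∀ {p} {P : Set p} (d : Dec P) → P → ⌊ d ⌋ ≡ true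
⌊⌋-yes (yes _) _ = refl
⌊⌋-yes (no ¬p) p = contradiction p ¬p

⌊⌋-no : ∀ {p} {P : Set p} (d : Dec P) → ¬ P → ⌊ d ⌋ ≡ false
⌊⌋-no (yes p) ¬p = contradiction p ¬p
⌊⌋-no (no _) _ = refl

sum-map-tabulate : ∀ {m n} (f : Fin m → ℕ) (g : Fin n → Fin m) →
                   ListAction.sum (map f (tabulate g)) ≡ sum (f ∘ g)
sum-map-tabulate {n = zero}  f g = refl
sum-map-tabulate {n = suc n} f g = cong (f (g zero) +_) (sum-map-tabulate f (g ∘ suc))

sum-map-allFin : ∀ {n} (f : Fin n → ℕ) → ListAction.sum (map f (allFin n)) ≡ sum f
sum-map-allFin f = sum-map-tabulate f (λ i → i)

sum-mono-≤ : ∀ {n} {f g : Fin n → ℕ} → (∀ i → f i ≤ g i) → sum f ≤ sum g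
sum-mono-≤ {zero}  f≤g = z≤n
sum-mono-≤ {suc n} f≤g = +-mono-≤ (f≤g zero) (sum-mono-≤ (f≤g ∘ suc))

term≤sum : ∀ {n} (f : Fin n → ℕ) i → f i ≤ sum f
term≤sum f zero    = m≤m+n (f zero) _
term≤sum f (suc i) = ≤-trans (term≤sum (f ∘ suc) i) (m≤n+m _ (f zero))

two-terms≤sum : ∀ {n} (f : Fin n → ℕ) {i j} → i ≢ j → f i + f j ≤ sum f
two-terms≤sum f {zero}  {zero}  i≢j = contradiction refl i≢j
two-terms≤sum f {zero}  {suc j} _   = +-monoʳ-≤ (f zero) (term≤sum (f ∘ suc) j)
two-terms≤sum f {suc i} {zero}  _   =
  ≤-trans (≤-reflexive (+-comm (f (suc i)) (f zero))) (+-monoʳ-≤ (f zero) (term≤sum (f ∘ suc) i))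
two-terms≤sum f {suc i} {suc j} i≢j =
  ≤-trans (two-terms≤sum (f ∘ suc) (i≢j ∘ cong suc)) (m≤n+m _ (f zero))

positive-term : ∀ {n} (f : Fin n → ℕ) → 0 < sum f → ∃ λ i → 0 < f i
positive-term {suc n} f pos with f zero in f₀≡
... | suc _ = zero , subst (0 <_) (sym f₀≡) (s≤s z≤n)
... | zero  with positive-term (f ∘ suc) pos
...   | i , fi>0 = suc i , fi>0

sum≤1⇒unique-positive : ∀ {n} (f : Fin n → ℕ) → sum f ≤ 1 →
                        ∀ {i j} → 0 < f i → 0 < f j → i ≡ j
sum≤1⇒unique-positive f sum≤1 {i} {j} fi>0 fj>0 with i ≟ j
... | yes i≡j = i≡j
... | no i≢j  =
  contradiction (≤-trans (+-mono-≤ fi>0 fj>0) (≤-trans (two-terms≤sum f i≢j) sum≤1)) λ { (s≤s ()) }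

sum-supported-at : ∀ {n} (f : Fin n → ℕ) u → (∀ i → i ≢ u → f i ≡ 0) → sum f ≡ f u
sum-supported-at {suc n} f u off = begin
  sum f                                    ≡⟨ sum-remove {i = u} f ⟩
  f u + sum (λ k → f (punchIn u k))        ≡⟨ cong (f u +_) (sum-cong-≗ (λ k → off _ (punchInᵢ≢i u k))) ⟩
  f u + sum {n} (λ _ → 0)                  ≡⟨ cong (f u +_) (sum-replicate-zero n) ⟩
  f u + 0                                  ≡⟨ +-identityʳ (f u) ⟩
  f u                                      ∎
  where open ≡-Reasoning

sum₂-distrib-+ : ∀ {m n} (f g : Fin m → Fin n → ℕ) →
                 sum (λ i → sum (λ j → f i j + g i j)) ≡ sum (λ i → sum (f i)) + sum (λ i → sum (g i))
sum₂-distrib-+ f g =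
  trans (sum-cong-≗ (λ i → ∑-distrib-+ (f i) (g i))) (∑-distrib-+ (λ i → sum (f i)) (λ i → sum (g i)))

count+count-not : ∀ b → count b + count (not b) ≡ 1
count+count-not true  = refl
count+count-not false = refl

count-positive : ∀ {b} → 0 < count b → b ≡ true
count-positive {true} _ = refl

count-true : ∀ {b} → b ≡ true → 0 < count b
count-true refl = s≤s z≤n

count-union₃ : ∀ {a b c d} → (a ≡ true → b ≡ true ⊎ c ≡ true ⊎ d ≡ true) →
               count a ≤ count b + (count c + count d)
count-union₃ {false} _ = z≤n
count-union₃ {true} {b} {c} {d} cases with cases refl
... | inj₁ refl        = s≤s z≤n
... | inj₂ (inj₁ refl) = ≤-trans (s≤s z≤n) (m≤n+m (1 + count d) (count b))
... | inj₂ (inj₂ refl) = ≤-trans (m≤n+m 1 (count c)) (m≤n+m (count c + 1) (count b))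

sum-ones : ∀ {n} (f : Fin n → ℕ) → (∀ i → f i ≡ 1) → sum f ≡ n
sum-ones {zero}  f ones = refl
sum-ones {suc n} f ones = cong₂ _+_ (ones zero) (sum-ones (f ∘ suc) (ones ∘ suc))

sum-count+sum-count-not : ∀ {n} (f : Fin n → Bool) →
                          sum (count ∘ f) + sum (λ i → count (not (f i))) ≡ n
sum-count+sum-count-not f =
  trans (sym (∑-distrib-+ (count ∘ f) (λ i → count (not (f i))))) (sum-ones _ (count+count-not ∘ f))

sum-count-≟∧ : ∀ {n} (u : Fin n) (b : Fin n → Bool) →
               sum (λ i → count (⌊ i ≟ u ⌋ ∧ b i)) ≡ count (b u)
sum-count-≟∧ u b =
  trans (sum-supported-at _ u (λ i i≢u → cong (λ x → count (x ∧ b i)) (⌊⌋-no (i ≟ u) i≢u)))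
        (cong (λ x → count (x ∧ b u)) (⌊⌋-yes (u ≟ u) refl))

sum-count≡1⇒unique : ∀ {n} (f : Fin n → Bool) → sum (count ∘ f) ≡ 1 →
                     ∃ λ a → f a ≡ true × (∀ i → f i ≡ true → i ≡ a)
sum-count≡1⇒unique f sum≡1 with positive-term (count ∘ f) (≤-reflexive (sym sum≡1))
... | a , fa>0 = a , count-positive fa>0 ,
                 λ i fi → sum≤1⇒unique-positive (count ∘ f) (≤-reflexive sum≡1) (count-true fi) fa>0

sum₂-count≡1⇒unique : ∀ {m n} (q : Fin m → Fin n → Bool) →
                      sum (λ i → sum (count ∘ q i)) ≡ 1 →
                      ∃₂ λ a b → q a b ≡ true × (∀ i j → q i j ≡ true → i ≡ a × j ≡ b)
sum₂-count≡1⇒unique q sum≡1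
  with positive-term (λ i → sum (count ∘ q i)) (≤-reflexive (sym sum≡1))
... | a , row-a>0 with positive-term (count ∘ q a) row-a>0
...   | b , qab>0 = a , b , count-positive qab>0 , unique
  where
  rows : Fin _ → ℕ
  rows i = sum (count ∘ q i)
  unique : ∀ i j → q i j ≡ true → i ≡ a × j ≡ b
  unique i j qij with sum≤1⇒unique-positive rows (≤-reflexive sum≡1)
                        (≤-trans (count-true qij) (term≤sum (count ∘ q i) j)) row-a>0
  ... | refl = refl , sum≤1⇒unique-positive (count ∘ q a)
                        (≤-trans (term≤sum rows a) (≤-reflexive sum≡1)) (count-true qij) qab>0

module _ {n} (G : Graph n) where

  inducedEdges-sum : ∀ S → inducedEdges G S ≡
                     sum (λ i → sum (λ j → count (⌊ i <? j ⌋ ∧ S i ∧ S j ∧ Adj G i j)))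
  inducedEdges-sum S =
    trans (sum-map-allFin (λ i → ListAction.sum (map (edge-in i) (allFin n))))
          (sum-cong-≗ (λ i → sum-map-allFin (edge-in i)))
    where
    edge-in : Fin n → Fin n → ℕ
    edge-in i j = count (⌊ i <? j ⌋ ∧ S i ∧ S j ∧ Adj G i j)

  degree-sum : ∀ u → degree G u ≡ sum (λ j → count (Adj G u j))
  degree-sum u = sum-map-allFin (λ j → count (Adj G u j))

  non-neighbours : Fin n → ℕ
  non-neighbours u = sum (λ w → count (not (Adj G u w)))

  degree+non-neighbours : ∀ u → degree G u + non-neighbours u ≡ n
  degree+non-neighbours u =
    trans (cong (_+ non-neighbours u) (degree-sum u)) (sum-count+sum-count-not (Adj G u))

  degree<order : ∀ u → degree G u < n
  degree<order u = begin
    1 + degree G u                                  ≡⟨ +-comm 1 (degree G u) ⟩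
    degree G u + 1                                  ≤⟨ +-monoʳ-≤ (degree G u) u≁u ⟩
    degree G u + non-neighbours u                   ≡⟨ degree+non-neighbours u ⟩
    n                                               ∎
    where
    open ≤-Reasoning
    u≁u : 1 ≤ non-neighbours u
    u≁u = subst (_≤ non-neighbours u) (cong (count ∘ not) (irrefl G u))
                (term≤sum (λ w → count (not (Adj G u w))) u)

  degree-maximal⇒universal : ∀ u → n ≤ suc (degree G u) → ∀ w → w ≢ u → Adj G u w ≡ true
  degree-maximal⇒universal u n≤1+deg w w≢u with Adj G u w in u≁w
  ... | true  = refl
  ... | false = ⊥-elim (<-irrefl refl (begin
    suc (suc (degree G u))                          ≡⟨ +-comm 2 (degree G u) ⟩
    degree G u + 2                                  ≤⟨ +-monoʳ-≤ (degree G u) u,w≁u ⟩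
    degree G u + non-neighbours u                   ≡⟨ degree+non-neighbours u ⟩
    n                                               ≤⟨ n≤1+deg ⟩
    suc (degree G u)                                ∎))
    where
    open ≤-Reasoning
    u,w≁u : 2 ≤ non-neighbours u
    u,w≁u = subst (_≤ non-neighbours u) (cong₂ (λ p q → count (not p) + count (not q)) (irrefl G u) u≁w)
                  (two-terms≤sum (λ x → count (not (Adj G u x))) (w≢u ∘ sym))

  edges-at≤degree : ∀ u → sum (λ j → count (⌊ u <? j ⌋ ∧ Adj G u j)) +
                          sum (λ i → count (⌊ i <? u ⌋ ∧ Adj G i u)) ≤ degree G u
  edges-at≤degree u = begin
    sum (λ j → count (⌊ u <? j ⌋ ∧ Adj G u j)) + sum (λ i → count (⌊ i <? u ⌋ ∧ Adj G i u))
      ≡⟨ ∑-distrib-+ (λ j → count (⌊ u <? j ⌋ ∧ Adj G u j)) (λ i → count (⌊ i <? u ⌋ ∧ Adj G i u)) ⟨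
    sum (λ j → count (⌊ u <? j ⌋ ∧ Adj G u j) + count (⌊ j <? u ⌋ ∧ Adj G j u))
      ≤⟨ sum-mono-≤ one-orientation ⟩
    sum (λ j → count (Adj G u j))
      ≡⟨ degree-sum u ⟨
    degree G u ∎
    where
    open ≤-Reasoning
    one-orientation : ∀ j → count (⌊ u <? j ⌋ ∧ Adj G u j) + count (⌊ j <? u ⌋ ∧ Adj G j u)
                            ≤ count (Adj G u j)
    one-orientation j rewrite adj-sym G j u with u <? j | j <? u
    ... | yes u<j | yes j<u = contradiction j<u (<-asym u<j)
    ... | yes _   | no _    = ≤-reflexive (+-identityʳ _)
    ... | no _    | yes _   = ≤-refl
    ... | no _    | no _    = z≤n

  edges≤inducedEdges+degree : ∀ S u → (∀ {i j} → Adj G i j ≡ true → S i ∧ S j ≡ true ⊎ i ≡ u ⊎ j ≡ u) →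
                              edges G ≤ inducedEdges G S + degree G u
  edges≤inducedEdges+degree S u cover = begin
    edges G
      ≡⟨ inducedEdges-sum (λ _ → true) ⟩
    sum (λ i → sum (λ j → count (edge i j)))
      ≤⟨ sum-mono-≤ (λ i → sum-mono-≤ (λ j → count-union₃ (classify i j))) ⟩
    sum (λ i → sum (λ j → count (inner i j) + (from-u i j + to-u i j)))
      ≡⟨ trans (sum₂-distrib-+ (λ i j → count (inner i j)) (λ i j → from-u i j + to-u i j))
               (cong (sum (λ i → sum (count ∘ inner i)) +_) (sum₂-distrib-+ from-u to-u)) ⟩
    sum (λ i → sum (count ∘ inner i)) + (sum (λ i → sum (from-u i)) + sum (λ i → sum (to-u i)))
      ≡⟨ cong₂ _+_ (sym (inducedEdges-sum S)) (cong₂ _+_ sum-from-u sum-to-u) ⟩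
    inducedEdges G S + (sum (λ j → count (edge u j)) + sum (λ i → count (edge i u)))
      ≤⟨ +-monoʳ-≤ (inducedEdges G S) (edges-at≤degree u) ⟩
    inducedEdges G S + degree G u ∎
    where
    open ≤-Reasoning
    edge inner : Fin n → Fin n → Bool
    edge  i j = ⌊ i <? j ⌋ ∧ Adj G i j
    inner i j = ⌊ i <? j ⌋ ∧ S i ∧ S j ∧ Adj G i j

    from-u to-u : Fin n → Fin n → ℕ
    from-u i j = count (⌊ i ≟ u ⌋ ∧ edge i j)
    to-u   i j = count (⌊ j ≟ u ⌋ ∧ edge i j)

    classify : ∀ i j → edge i j ≡ true →
               inner i j ≡ true ⊎ ⌊ i ≟ u ⌋ ∧ edge i j ≡ true ⊎ ⌊ j ≟ u ⌋ ∧ edge i j ≡ true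
    classify i j e with ∧-conicalˡ ⌊ i <? j ⌋ (Adj G i j) e | ∧-conicalʳ ⌊ i <? j ⌋ (Adj G i j) e
    ... | i<j | i~j with cover i~j
    ...   | inj₁ Si∧Sj = inj₁ (cong₂ _∧_ i<j (cong₂ _∧_ (∧-conicalˡ (S i) (S j) Si∧Sj)
                                                      (cong₂ _∧_ (∧-conicalʳ (S i) (S j) Si∧Sj) i~j)))
    ...   | inj₂ (inj₁ i≡u) = inj₂ (inj₁ (cong₂ _∧_ (⌊⌋-yes (i ≟ u) i≡u) e))
    ...   | inj₂ (inj₂ j≡u) = inj₂ (inj₂ (cong₂ _∧_ (⌊⌋-yes (j ≟ u) j≡u) e))

    sum-from-u : sum (λ i → sum (from-u i)) ≡ sum (λ j → count (edge u j))
    sum-from-u = trans (∑-comm from-u)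
                   (sum-cong-≗ (λ j → sum-count-≟∧ u (λ i → edge i j)))

    sum-to-u : sum (λ i → sum (to-u i)) ≡ sum (λ i → count (edge i u))
    sum-to-u = sum-cong-≗ (λ i → sum-count-≟∧ u (edge i))

leaf-neighbour : ∀ {n} (G : Graph n) v → isLeaf G v →
                 ∃ λ u → Adj G v u ≡ true × (∀ w → Adj G v w ≡ true → w ≡ u)
leaf-neighbour G v leaf = sum-count≡1⇒unique (Adj G v) (trans (sym (degree-sum G v)) leaf)

record StarWithChord {n} (G : Graph n) (u a b : Fin n) : Set where
  field
    hub    : ∀ w → w ≢ u → Adj G u w ≡ true
    chord  : Adj G a b ≡ true
    offHub : ∀ {i j} → Adj G i j ≡ true → i ≢ u → j ≢ u → i ≡ a ⊎ i ≡ b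

  a≢b : a ≢ b
  a≢b refl = contradiction (trans (sym chord) (irrefl G a)) λ ()

module LeafNeighbourhood {n} (G : Graph n) {v u : Fin n}
                         (v~u : Adj G v u ≡ true) (only-u : ∀ w → Adj G v w ≡ true → w ≡ u) where

  outside : Fin n → Bool
  outside w = not (closedNbhd G v w)

  outer-edge : Fin n → Fin n → Bool
  outer-edge i j = ⌊ i <? j ⌋ ∧ outside i ∧ outside j ∧ Adj G i j

  outside-u : outside u ≡ false
  outside-u = cong not (trans (cong (⌊ v ≟ u ⌋ ∨_) v~u) (∨-zeroʳ ⌊ v ≟ u ⌋))

  outside⇒≢u : ∀ {w} → outside w ≡ true → u ≢ w
  outside⇒≢u ow refl = contradiction (trans (sym ow) outside-u) λ ()

  edge-off-u-outside : ∀ {i j} → Adj G i j ≡ true → i ≢ u → j ≢ u → outside i ≡ true × outside j ≡ true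
  edge-off-u-outside {i} {j} i~j i≢u j≢u = outside-intro i≢v i≢u , outside-intro j≢v j≢u
    where
    outside-intro : ∀ {w} → w ≢ v → w ≢ u → outside w ≡ true
    outside-intro {w} w≢v w≢u with v ≟ w | Adj G v w in v~w
    ... | yes v≡w | _     = contradiction (sym v≡w) w≢v
    ... | no _    | true  = contradiction (only-u w v~w) w≢u
    ... | no _    | false = refl
    i≢v : i ≢ v
    i≢v refl = j≢u (only-u j i~j)
    j≢v : j ≢ v
    j≢v refl = i≢u (only-u i (trans (adj-sym G v i) i~j))

  edges≤outerEdges+degree : edges G ≤ edgesMinusClosedNbhd G v + degree G u
  edges≤outerEdges+degree = edges≤inducedEdges+degree G outside u cover
    where
    cover : ∀ {i j} → Adj G i j ≡ true → outside i ∧ outside j ≡ true ⊎ i ≡ u ⊎ j ≡ u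
    cover {i} {j} i~j with i ≟ u | j ≟ u
    ... | yes i≡u | _       = inj₂ (inj₁ i≡u)
    ... | no _    | yes j≡u = inj₂ (inj₂ j≡u)
    ... | no i≢u  | no j≢u  = let oi , oj = edge-off-u-outside i~j i≢u j≢u in inj₁ (cong₂ _∧_ oi oj)

  one-outer-edge⇒starWithChord : edgesMinusClosedNbhd G v ≡ 1 → (∀ w → w ≢ u → Adj G u w ≡ true) →
                                 ∃₂ λ a b → u ≢ a × u ≢ b × StarWithChord G u a b
  one-outer-edge⇒starWithChord outer≡1 hub
    with sum₂-count≡1⇒unique outer-edge (trans (sym (inducedEdges-sum G outside)) outer≡1)
  ... | a , b , ab , unique =
    a , b , outside⇒≢u oa , outside⇒≢u ob , record { hub = hub ; chord = a~b ; offHub = offHub }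
    where
    oa : outside a ≡ true
    oa = ∧-conicalˡ (outside a) _ (∧-conicalʳ ⌊ a <? b ⌋ _ ab)
    ob : outside b ≡ true
    ob = ∧-conicalˡ (outside b) _ (∧-conicalʳ (outside a) _ (∧-conicalʳ ⌊ a <? b ⌋ _ ab))
    a~b : Adj G a b ≡ true
    a~b = ∧-conicalʳ (outside b) _ (∧-conicalʳ (outside a) _ (∧-conicalʳ ⌊ a <? b ⌋ _ ab))

    outer-edge-intro : ∀ {i j} → i <ᶠ j → Adj G i j ≡ true → i ≢ u → j ≢ u → outer-edge i j ≡ true
    outer-edge-intro {i} {j} i<j i~j i≢u j≢u =
      let oi , oj = edge-off-u-outside i~j i≢u j≢u
      in cong₂ _∧_ (⌊⌋-yes (i <? j) i<j) (cong₂ _∧_ oi (cong₂ _∧_ oj i~j))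

    offHub : ∀ {i j} → Adj G i j ≡ true → i ≢ u → j ≢ u → i ≡ a ⊎ i ≡ b
    offHub {i} {j} i~j i≢u j≢u with <-cmp i j
    ... | tri< i<j _ _  = inj₁ (proj₁ (unique i j (outer-edge-intro i<j i~j i≢u j≢u)))
    ... | tri≈ _ refl _ = contradiction (trans (sym i~j) (irrefl G i)) λ ()
    ... | tri> _ _ j<i  = inj₂ (proj₂ (unique j i (outer-edge-intro j<i (trans (adj-sym G j i) i~j) j≢u i≢u)))

transpose-hit : ∀ {n} (i j : Fin n) → Components.transpose i j i ≡ j
transpose-hit i j rewrite dec-true (i ≟ i) refl = refl

transpose-miss : ∀ {n} {i j k : Fin n} → k ≢ i → k ≢ j → Components.transpose i j k ≡ k
transpose-miss {i = i} {j} {k} k≢i k≢j rewrite dec-false (k ≟ i) k≢i | dec-false (k ≟ j) k≢j = refl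

redirect : ∀ {n} → Permutation′ n → Fin n → Fin n → Permutation′ n
redirect π i c = transpose i (π ⟨$⟩ˡ c) ∘ₚ π

redirect-hit : ∀ {n} (π : Permutation′ n) i c → redirect π i c ⟨$⟩ʳ i ≡ c
redirect-hit π i c = trans (cong (π ⟨$⟩ʳ_) (transpose-hit i (π ⟨$⟩ˡ c))) (inverseʳ π)

redirect-miss : ∀ {n} (π : Permutation′ n) {i c x} → x ≢ i → π ⟨$⟩ʳ x ≢ c →
                redirect π i c ⟨$⟩ʳ x ≡ π ⟨$⟩ʳ x
redirect-miss π x≢i πx≢c =
  cong (π ⟨$⟩ʳ_) (transpose-miss x≢i (λ x≡ → πx≢c (trans (cong (π ⟨$⟩ʳ_) x≡) (inverseʳ π))))

relabel₃ : ∀ {m} {u a b : Fin (3 + m)} → u ≢ a → u ≢ b → a ≢ b →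
           Σ (Permutation′ (3 + m)) λ τ → τ ⟨$⟩ʳ 0F ≡ u × τ ⟨$⟩ʳ 1F ≡ a × τ ⟨$⟩ʳ 2F ≡ b
relabel₃ {m} {u} {a} {b} u≢a u≢b a≢b = τ₃ , τ₃0 , τ₃1 , redirect-hit τ₂ 2F b
  where
  τ₁ τ₂ τ₃ : Permutation′ (3 + m)
  τ₁ = redirect id 0F u
  τ₂ = redirect τ₁ 1F a
  τ₃ = redirect τ₂ 2F b
  τ₁0 : τ₁ ⟨$⟩ʳ 0F ≡ u
  τ₁0 = redirect-hit id 0F u
  τ₂1 : τ₂ ⟨$⟩ʳ 1F ≡ a
  τ₂1 = redirect-hit τ₁ 1F a
  τ₂0 : τ₂ ⟨$⟩ʳ 0F ≡ u
  τ₂0 = trans (redirect-miss τ₁ {1F} {a} {0F} (λ ()) (λ e → u≢a (trans (sym τ₁0) e))) τ₁0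
  τ₃0 : τ₃ ⟨$⟩ʳ 0F ≡ u
  τ₃0 = trans (redirect-miss τ₂ {2F} {b} {0F} (λ ()) (λ e → u≢b (trans (sym τ₂0) e))) τ₂0
  τ₃1 : τ₃ ⟨$⟩ʳ 1F ≡ a
  τ₃1 = trans (redirect-miss τ₂ {2F} {b} {1F} (λ ()) (λ e → a≢b (trans (sym τ₂1) e))) τ₂1

isoTo-by-relabelling : ∀ {n} (G : Graph n) (H : Fin n → Fin n → Bool) (τ : Permutation′ n) →
                       (∀ x y → Adj G (τ ⟨$⟩ʳ x) (τ ⟨$⟩ʳ y) ≡ H x y) → IsoTo G H
isoTo-by-relabelling G H τ relabelled =
  flip τ , λ i j → trans (sym (cong₂ (Adj G) (inverseʳ τ) (inverseʳ τ))) (relabelled (τ ⟨$⟩ˡ i) (τ ⟨$⟩ˡ j))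

starWithChord-relabelled : ∀ {m} {G : Graph (3 + m)} (τ : Permutation′ (3 + m)) →
                           StarWithChord G (τ ⟨$⟩ʳ 0F) (τ ⟨$⟩ʳ 1F) (τ ⟨$⟩ʳ 2F) →
                           ∀ x y → Adj G (τ ⟨$⟩ʳ x) (τ ⟨$⟩ʳ y) ≡ UAdj (3 + m) x y
starWithChord-relabelled {m} {G} τ star = adj
  where
  open StarWithChord star

  τ-≢ : ∀ {x y} → x ≢ y → τ ⟨$⟩ʳ x ≢ τ ⟨$⟩ʳ y
  τ-≢ x≢y e = x≢y (trans (sym (inverseˡ τ)) (trans (cong (τ ⟨$⟩ˡ_) e) (inverseˡ τ)))

  isolated : ∀ k y → y ≢ 0F → Adj G (τ ⟨$⟩ʳ suc (suc (suc k))) (τ ⟨$⟩ʳ y) ≡ false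
  isolated k y y≢0 with Adj G (τ ⟨$⟩ʳ suc (suc (suc k))) (τ ⟨$⟩ʳ y) in e
  ... | false = refl
  ... | true with offHub e (τ-≢ λ ()) (τ-≢ y≢0)
  ...   | inj₁ ≡a = contradiction ≡a (τ-≢ λ ())
  ...   | inj₂ ≡b = contradiction ≡b (τ-≢ λ ())

  -- UAdj computes to a literal on each pattern below, so every clause is a plain adjacency fact.
  adj : ∀ x y → Adj G (τ ⟨$⟩ʳ x) (τ ⟨$⟩ʳ y) ≡ UAdj (3 + m) x y
  adj 0F      0F                  = irrefl G _
  adj 0F      (suc y)             = hub _ (τ-≢ λ ())
  adj (suc x) 0F                  = trans (adj-sym G _ _) (hub _ (τ-≢ λ ()))
  adj 1F      1F                  = irrefl G _
  adj 1F      2F                  = chord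
  adj 1F      (suc (suc (suc l))) = trans (adj-sym G _ _) (isolated l 1F λ ())
  adj 2F      1F                  = trans (adj-sym G _ _) chord
  adj 2F      2F                  = irrefl G _
  adj 2F      (suc (suc (suc l))) = trans (adj-sym G _ _) (isolated l 2F λ ())
  adj (suc (suc (suc k))) (suc y) = isolated k (suc y) λ ()

starWithChord⇒≅U : ∀ {n} {G : Graph n} {u a b} → u ≢ a → u ≢ b → StarWithChord G u a b → IsoTo G (UAdj n)
starWithChord⇒≅U {1} {u = 0F} {0F} u≢a _ _ = contradiction refl u≢a
starWithChord⇒≅U {2} u≢a u≢b star = ⊥-elim (no-three-distinct u≢a u≢b (StarWithChord.a≢b star))
  where
  no-three-distinct : {u a b : Fin 2} → u ≢ a → u ≢ b → a ≢ b → ⊥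
  no-three-distinct {0F} {0F}      u≢a _   _   = u≢a refl
  no-three-distinct {0F} {1F} {0F} _   u≢b _   = u≢b refl
  no-three-distinct {0F} {1F} {1F} _   _   a≢b = a≢b refl
  no-three-distinct {1F} {1F}      u≢a _   _   = u≢a refl
  no-three-distinct {1F} {0F} {0F} _   _   a≢b = a≢b refl
  no-three-distinct {1F} {0F} {1F} _   u≢b _   = u≢b refl
starWithChord⇒≅U {suc (suc (suc m))} {G} u≢a u≢b star
  with relabel₃ u≢a u≢b (StarWithChord.a≢b star)
... | τ , refl , refl , refl = isoTo-by-relabelling G (UAdj (3 + m)) τ (starWithChord-relabelled τ star)

≤-+-squeeze : ∀ {n e d} → n ≤ e + d → d < n → e < 2 → e ≡ 1 × n ≤ suc d
≤-+-squeeze {e = 0}           n≤d   d<n _ = contradiction n≤d (<⇒≱ d<n)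
≤-+-squeeze {e = 1}           n≤1+d _   _ = refl , n≤1+d
≤-+-squeeze {e = suc (suc _)} _     _   (s≤s (s≤s ()))

lemma3p3 : ∀ {n} (G : Graph n) → Unicyclic G →
           ¬ IsoTo G (UAdj n) → ¬ IsoTo G (cycleAdj n) →
           ∀ v → isLeaf G v → edgesMinusClosedNbhd G v ≥ 2
lemma3p3 G (_ , edges≡n) G≇U _ v leaf with leaf-neighbour G v leaf
... | u , v~u , only-u = ≮⇒≥ λ outer<2 →
  let n≤outer+deg = subst (_≤ edgesMinusClosedNbhd G v + degree G u) edges≡n edges≤outerEdges+degree
      outer≡1 , n≤1+deg = ≤-+-squeeze n≤outer+deg (degree<order G u) outer<2
      a , b , u≢a , u≢b , star =
        one-outer-edge⇒starWithChord outer≡1 (degree-maximal⇒universal G u n≤1+deg)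
  in G≇U (starWithChord⇒≅U u≢a u≢b star)
  where open LeafNeighbourhood G v~u only-u
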